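{- Let $d\geq 1$ be an integer. If $Q$ is a finite (left) quasifield with $q$ elements and $A\subset Q$ with $|A| > q^{\frac{d+2}{2d+2}}$, then \[ Q = A + A + \underbrace{A\cdot A + \cdots + A\cdot A}_{d\ \text{terms}}, \] i.e., every element of $Q$ can be written as $a + a' + a_1\cdot a_1' + \cdots + a_d\cdot a_d'$ with all $a,a',a_i,a_i'\in A$.
   Context: A (left) quasifield is a set $Q$ with two binary operations $+$ and $\cdot$ such that $(Q,+)$ is a group with identity $0$; $(Q\setminus\{0\},\cdot)$ is a loop (for all $a,b$ the equations $a\cdot x=b$ and $y\cdot a=b$ have unique solutions, and there is an identity $1$); $a\cdot(b+c)=a\cdot b+a\cdot c$ for all $a,b,c$; $0\cdot x=0$ for all $x$; and for $a\neq b$ the equation $a\cdot x=b\cdot x+c$ has exactly one solution $x$. ($(Q,+)$ is then abelian.) -}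

module Defs where

open import Data.Nat using (ℕ; zero; suc)
open import Data.Fin using (Fin)
import Data.Fin as F
open import Data.Product using (Σ; _×_; _,_)
open import Relation.Binary.PropositionalEquality using (_≡_; _≢_)
open import Algebra.Core using (Op₁; Op₂)
open import Algebra.Structures using (IsGroup)

∃!′ : {A : Set} → (A → Set) → Set
∃!′ {A} P = Σ A λ x → P x × (∀ y → P y → y ≡ x)

record Quasifield (q : ℕ) : Set where
  infixl 6 _+_
  infixl 7 _·_
  field
    _+_ : Op₂ (Fin q)
    _·_ : Op₂ (Fin q)
    0#  : Fin q
    -_  : Op₁ (Fin q)
    1#  : Fin q
    +-isGroup : IsGroup _≡_ _+_ 0# -_
    1≢0      : 1# ≢ 0#
    ·-closed : ∀ a b → a ≢ 0# → b ≢ 0# → a · b ≢ 0#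
    ·-identityˡ : ∀ x → x ≢ 0# → 1# · x ≡ x
    ·-identityʳ : ∀ x → x ≢ 0# → x · 1# ≡ x
    left-div  : ∀ a b → a ≢ 0# → b ≢ 0# → ∃!′ (λ x → x ≢ 0# × a · x ≡ b)
    right-div : ∀ a b → a ≢ 0# → b ≢ 0# → ∃!′ (λ y → y ≢ 0# × y · a ≡ b)
    distribˡ : ∀ a b c → a · (b + c) ≡ a · b + a · c
    zeroˡ : ∀ x → 0# · x ≡ 0#
    unique-sol : ∀ a b c → a ≢ b → ∃!′ (λ x → a · x ≡ b · x + c)

addProds : ∀ {q} → Quasifield q → Fin q → (d : ℕ) → (Fin d → Fin q) → (Fin d → Fin q) → Fin q
addProds Q acc zero b c = acc
addProds Q acc (suc d) b c =
  addProds Q (acc + (b F.zero · c F.zero)) d (λ i → b (F.suc i)) (λ i → c (F.suc i))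
  where open Quasifield Q

{-# OPTIONS --safe #-}

-- Let ι be the indicator of A, m = ∣A∣, and P h (w) = Σ_{b,c ∈ A} h (w − b·c).  The number of
-- ways to write z = a + a′ + b₁c₁ + ⋯ + b_d c_d is (Pᵈ ν)(z), where ν(x) = count-A+A x is the
-- number of ways to write x = a + a′.
-- Splitting q·ι = m + α with Σ α = 0 gives
--   q² (Pᵈ ν)(z) = q m^(2d+2) + Σ_a α(a) (Pᵈ α)(z − a).
-- For b ≠ b′ the map c ↦ b′c − bc is a bijection of Q (the last quasifield axiom), so for Σ h = 0
-- the translates h(· − bc) and h(· − b′c) are orthogonal on average over c; with Cauchy–Schwarz
-- this gives ‖P h‖² ≤ m² q ‖h‖².  The error term is therefore at most
-- ‖α‖² (m² q)^(d/2) ≤ q² m (m² q)^(d/2), which is smaller than the main term q m^(2d+2) as soon as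
-- q^(d+2) < m^(2d+2).

module Submission where

open import Defs
open import Data.Fin using (Fin)
open import Data.Fin.Subset using (Subset; _∈_; ∣_∣)
open import Data.Product using (Σ; _×_; _,_)
open import Relation.Binary.PropositionalEquality using (_≡_)
open import Algebra.Structures using (IsGroup)

module Integers where

  open import Data.Nat as ℕ using (zero; suc; z≤n)
  open import Data.Fin using (zero; suc)
  open import Data.Fin.Permutation using (permutation)
  open import Data.Fin.Properties using (suc-injective)
  open import Data.Integer using (ℤ; +_; -[1+_]; 0ℤ; 1ℤ; _+_; _*_; -_; _-_; _^_; _≤_; +≤+; nonNegative)
  import Data.Integer.Properties as ℤ
  open import Data.Integer.Tactic.RingSolver using (solve-∀)
  open import Algebra.Properties.Semiring.Sum ℤ.+-*-semiring public
    using (sum; sum-syntax; sum-cong-≗; sum-replicate-zero; ∑-distrib-+; ∑-comm; *-distribˡ-sum; *-distribʳ-sum)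
  open import Algebra.Properties.Semiring.Sum ℤ.+-*-semiring using (sum-permute)
  open import Data.Bool using (true; false; if_then_else_)
  open import Data.Vec using (_∷_; []; lookup)
  open import Data.Vec.Properties using (lookup⇒[]=)
  open import Data.Empty using (⊥-elim)
  open import Function using (_∘_)
  open import Relation.Nullary using (yes; no)
  open import Relation.Binary.PropositionalEquality

  pos-^ : ∀ m k → + (m ℕ.^ k) ≡ (+ m) ^ k
  pos-^ m zero    = refl
  pos-^ m (suc k) = trans (ℤ.pos-* m (m ℕ.^ k)) (cong (+ m *_) (pos-^ m k))

  pos-nonNeg : ∀ n → 0ℤ ≤ + n
  pos-nonNeg n = +≤+ z≤n

  *-nonNeg : ∀ {i j} → 0ℤ ≤ i → 0ℤ ≤ j → 0ℤ ≤ i * j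
  *-nonNeg {+ m} {+ n} _ _ = subst (0ℤ ≤_) (ℤ.pos-* m n) (+≤+ z≤n)

  ^-nonNeg : ∀ {i} k → 0ℤ ≤ i → 0ℤ ≤ i ^ k
  ^-nonNeg zero    0≤i = pos-nonNeg 1
  ^-nonNeg (suc k) 0≤i = *-nonNeg 0≤i (^-nonNeg k 0≤i)

  *-mono-≤-nonNeg : ∀ {i j k l} → 0ℤ ≤ i → 0ℤ ≤ l → i ≤ j → k ≤ l → i * k ≤ j * l
  *-mono-≤-nonNeg {i} {j} {k} {l} 0≤i 0≤l i≤j k≤l = ℤ.≤-trans
    (ℤ.*-monoˡ-≤-nonNeg i {{nonNegative 0≤i}} k≤l) (ℤ.*-monoʳ-≤-nonNeg l {{nonNegative 0≤l}} i≤j)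

  ‖_‖² : ∀ {n} → (Fin n → ℤ) → ℤ
  ‖ f ‖² = ∑[ x < _ ] (f x * f x)

  sum-const : ∀ n c → ∑[ _ < n ] c ≡ + n * c
  sum-const zero    c = refl
  sum-const (suc n) c = begin
    c + ∑[ _ < n ] c ≡⟨ cong (λ t → c + t) (sum-const n c) ⟩
    c + + n * c      ≡⟨ cong (_+ + n * c) (sym (ℤ.*-identityˡ c)) ⟩
    1ℤ * c + + n * c ≡⟨ sym (ℤ.*-distribʳ-+ c 1ℤ (+ n)) ⟩
    + suc n * c      ∎
    where open ≡-Reasoning

  sum≢0⇒∃≢0 : ∀ {n} (f : Fin n → ℤ) → sum f ≢ 0ℤ → Σ (Fin n) λ x → f x ≢ 0ℤ
  sum≢0⇒∃≢0 {zero}  f ∑f≢0 = ⊥-elim (∑f≢0 refl)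
  sum≢0⇒∃≢0 {suc n} f ∑f≢0 with f zero ℤ.≟ 0ℤ
  ... | no  f₀≢0 = zero , f₀≢0
  ... | yes f₀≡0 with sum≢0⇒∃≢0 (f ∘ suc) (λ ∑≡0 → ∑f≢0 (cong₂ _+_ f₀≡0 ∑≡0))
  ...   | x , fx≢0 = suc x , fx≢0

  sum-mono-≤ : ∀ {n} {f g : Fin n → ℤ} → (∀ x → f x ≤ g x) → sum f ≤ sum g
  sum-mono-≤ {zero}  f≤g = ℤ.≤-refl
  sum-mono-≤ {suc n} f≤g = ℤ.+-mono-≤ (f≤g zero) (sum-mono-≤ (f≤g ∘ suc))

  sum-nonNeg : ∀ {n} {f : Fin n → ℤ} → (∀ x → 0ℤ ≤ f x) → 0ℤ ≤ sum f
  sum-nonNeg {n} {f} 0≤f = subst (_≤ sum f) (sum-replicate-zero n) (sum-mono-≤ 0≤f)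

  square-nonNeg : ∀ i → 0ℤ ≤ i * i
  square-nonNeg (+ n)    = *-nonNeg (pos-nonNeg n) (pos-nonNeg n)
  square-nonNeg -[1+ n ] = +≤+ z≤n

  ‖‖²-nonNeg : ∀ {n} (f : Fin n → ℤ) → 0ℤ ≤ ‖ f ‖²
  ‖‖²-nonNeg f = sum-nonNeg (λ x → square-nonNeg (f x))

  sum-reindex : ∀ {n} (f : Fin n → ℤ) (σ τ : Fin n → Fin n) →
                (∀ x → σ (τ x) ≡ x) → (∀ x → τ (σ x) ≡ x) → sum f ≡ sum (f ∘ σ)
  sum-reindex f σ τ στ τσ = sum-permute f (permutation σ τ στ τσ)

  sum-single-support : ∀ {n} (f : Fin n → ℤ) x → (∀ y → y ≢ x → f y ≡ 0ℤ) → sum f ≡ f x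
  sum-single-support {suc n} f zero    f≡0 = begin
    f zero + ∑[ y < n ] f (suc y) ≡⟨ cong (λ t → f zero + t) (trans (sum-cong-≗ rest≡0) (sum-replicate-zero n)) ⟩
    f zero + 0ℤ                   ≡⟨ ℤ.+-identityʳ (f zero) ⟩
    f zero                        ∎
    where
    open ≡-Reasoning
    rest≡0 : ∀ y → f (suc y) ≡ 0ℤ
    rest≡0 y = f≡0 (suc y) λ ()
  sum-single-support {suc n} f (suc x) f≡0 = begin
    f zero + ∑[ y < n ] f (suc y) ≡⟨ cong₂ _+_ (f≡0 zero λ ()) (sum-single-support (f ∘ suc) x rest≡0) ⟩
    0ℤ + f (suc x)                ≡⟨ ℤ.+-identityˡ (f (suc x)) ⟩
    f (suc x)                     ∎
    where
    open ≡-Reasoning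
    rest≡0 : ∀ y → y ≢ x → f (suc y) ≡ 0ℤ
    rest≡0 y y≢x = f≡0 (suc y) (y≢x ∘ suc-injective)

  sum-linear₃ : ∀ {n} a b c (f g h : Fin n → ℤ) →
    ∑[ i < n ] (a * f i + (b * g i + c * h i)) ≡ a * sum f + (b * sum g + c * sum h)
  sum-linear₃ a b c f g h = trans (∑-distrib-+ (λ i → a * f i) _)
    (cong₂ _+_ (sym (*-distribˡ-sum a f))
      (trans (∑-distrib-+ (λ i → b * g i) _) (cong₂ _+_ (sym (*-distribˡ-sum b g)) (sym (*-distribˡ-sum c h)))))

  sum-shifted-product : ∀ {n} (f g : Fin n → ℤ) a b →
    ∑[ i < n ] ((f i + a) * (g i + b)) ≡ ∑[ i < n ] (f i * g i) + (b * sum f + (a * sum g + + n * (a * b)))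
  sum-shifted-product {n} f g a b = begin
    ∑[ i < n ] ((f i + a) * (g i + b))
      ≡⟨ sum-cong-≗ (λ i → expand (f i) (g i) a b) ⟩
    ∑[ i < n ] (f i * g i + (b * f i + (a * g i + a * b)))
      ≡⟨ ∑-distrib-+ (λ i → f i * g i) _ ⟩
    ∑[ i < n ] (f i * g i) + ∑[ i < n ] (b * f i + (a * g i + a * b))
      ≡⟨ cong (λ s → ∑[ i < n ] (f i * g i) + s) (trans (∑-distrib-+ (λ i → b * f i) _)
           (cong₂ _+_ (sym (*-distribˡ-sum b f)) (trans (∑-distrib-+ (λ i → a * g i) _)
             (cong₂ _+_ (sym (*-distribˡ-sum a g)) (sum-const n (a * b)))))) ⟩
    ∑[ i < n ] (f i * g i) + (b * sum f + (a * sum g + + n * (a * b))) ∎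
    where
    open ≡-Reasoning
    expand : ∀ x y a b → (x + a) * (y + b) ≡ x * y + (b * x + (a * y + a * b))
    expand = solve-∀

  lagrange-identity : ∀ {n} (f g : Fin n → ℤ) x y →
    ∑[ i < n ] ((x * g i - y * f i) * (x * g i - y * f i))
      ≡ x * x * ‖ g ‖² + (y * y * ‖ f ‖² + (- (x * y + x * y)) * ∑[ i < n ] (f i * g i))
  lagrange-identity f g x y = trans (sum-cong-≗ (λ i → expand x y (f i) (g i)))
    (sum-linear₃ (x * x) (y * y) (- (x * y + x * y)) (λ i → g i * g i) (λ i → f i * f i) (λ i → f i * g i))
    where
    expand : ∀ x y a b → (x * b - y * a) * (x * b - y * a)
                         ≡ x * x * (b * b) + (y * y * (a * a) + (- (x * y + x * y)) * (a * b))
    expand = solve-∀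

  cauchy-schwarz : ∀ {n} (f g : Fin n → ℤ) → let s = ∑[ i < n ] (f i * g i) in s * s ≤ ‖ f ‖² * ‖ g ‖²
  cauchy-schwarz {zero}  f g = ℤ.≤-refl
  cauchy-schwarz {suc n} f g = ℤ.0≤i-j⇒j≤i (subst (0ℤ ≤_) (sym split) (ℤ.+-mono-≤ (ℤ.i≤j⇒0≤j-i ih) cross≥0))
    where
    x = f zero
    y = g zero
    F = ‖ f ∘ suc ‖²
    G = ‖ g ∘ suc ‖²
    S = ∑[ i < n ] (f (suc i) * g (suc i))
    ih : S * S ≤ F * G
    ih = cauchy-schwarz (f ∘ suc) (g ∘ suc)
    cross = ∑[ i < n ] ((x * g (suc i) - y * f (suc i)) * (x * g (suc i) - y * f (suc i)))
    cross≥0 : 0ℤ ≤ cross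
    cross≥0 = sum-nonNeg (λ i → square-nonNeg (x * g (suc i) - y * f (suc i)))
    regroup : ∀ x y F G S → (x * x + F) * (y * y + G) - (x * y + S) * (x * y + S)
                            ≡ (F * G - S * S) + (x * x * G + (y * y * F + (- (x * y + x * y)) * S))
    regroup = solve-∀
    split : (x * x + F) * (y * y + G) - (x * y + S) * (x * y + S) ≡ (F * G - S * S) + cross
    split = trans (regroup x y F G S) (cong (λ t → (F * G - S * S) + t) (sym (lagrange-identity (f ∘ suc) (g ∘ suc) x y)))

  ∑-comm₃ : ∀ {n} (f : Fin n → Fin n → Fin n → ℤ) →
    ∑[ x < n ] ∑[ y < n ] ∑[ z < n ] f x y z ≡ ∑[ y < n ] ∑[ z < n ] ∑[ x < n ] f x y z
  ∑-comm₃ f = trans (∑-comm (λ x y → sum (f x y))) (sum-cong-≗ (λ y → ∑-comm (λ x → f x y)))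

  square-sum : ∀ {n} (f : Fin n → ℤ) → sum f * sum f ≡ ∑[ x < n ] ∑[ y < n ] (f x * f y)
  square-sum f = trans (*-distribʳ-sum (sum f) f) (sum-cong-≗ (λ x → *-distribˡ-sum (f x) f))

  i*j≢0⇒i≢0 : ∀ i j → i * j ≢ 0ℤ → i ≢ 0ℤ
  i*j≢0⇒i≢0 i j ij≢0 refl = ij≢0 refl

  i*j≢0⇒j≢0 : ∀ i j → i * j ≢ 0ℤ → j ≢ 0ℤ
  i*j≢0⇒j≢0 i j ij≢0 refl = ij≢0 (ℤ.*-zeroʳ i)

  indicator : ∀ {n} → Subset n → Fin n → ℤ
  indicator A x = if lookup A x then 1ℤ else 0ℤ

  sum-indicator : ∀ {n} (A : Subset n) → sum (indicator A) ≡ + ∣ A ∣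
  sum-indicator []          = refl
  sum-indicator (true ∷ A)  = trans (cong (λ t → 1ℤ + t) (sum-indicator A)) (sym (ℤ.pos-+ 1 ∣ A ∣))
  sum-indicator (false ∷ A) = trans (ℤ.+-identityˡ _) (sum-indicator A)

  indicator-idem : ∀ {n} (A : Subset n) x → indicator A x * indicator A x ≡ indicator A x
  indicator-idem A x with lookup A x
  ... | true  = refl
  ... | false = refl

  ‖indicator‖² : ∀ {n} (A : Subset n) → ‖ indicator A ‖² ≡ + ∣ A ∣
  ‖indicator‖² A = trans (sum-cong-≗ (indicator-idem A)) (sum-indicator A)

  indicator≢0⇒∈ : ∀ {n} (A : Subset n) x → indicator A x ≢ 0ℤ → x ∈ A
  indicator≢0⇒∈ A x ιx≢0 with lookup A x in eq
  ... | true  = lookup⇒[]= x A eq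
  ... | false = ⊥-elim (ιx≢0 refl)

module GroupSums {n} {_∙_ : Fin n → Fin n → Fin n} {ε : Fin n} {_⁻¹ : Fin n → Fin n}
                 (isGroup : IsGroup _≡_ _∙_ ε _⁻¹) where

  open import Algebra.Bundles using (Group)
  open import Data.Integer using (ℤ)
  open import Relation.Binary.PropositionalEquality using (sym; trans)

  private
    group : Group _ _
    group = record { isGroup = isGroup }

  open import Algebra.Properties.Group group public
    using (\\-leftDividesˡ; \\-leftDividesʳ; //-rightDividesˡ; //-rightDividesʳ; ⁻¹-involutive; inverseʳ-unique)
  open Integers using (sum; sum-reindex)

  sum-∙ˡ : ∀ t (f : Fin n → ℤ) → sum f ≡ sum (λ x → f (t ∙ x))
  sum-∙ˡ t f = sum-reindex f (t ∙_) ((t ⁻¹) ∙_) (\\-leftDividesˡ t) (\\-leftDividesʳ t)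

  sum-∙ʳ : ∀ t (f : Fin n → ℤ) → sum f ≡ sum (λ x → f (x ∙ t))
  sum-∙ʳ t f = sum-reindex f (_∙ t) (_∙ (t ⁻¹)) (//-rightDividesˡ t) (//-rightDividesʳ t)

  sum-⁻¹ : ∀ (f : Fin n → ℤ) → sum f ≡ sum (λ x → f (x ⁻¹))
  sum-⁻¹ f = sum-reindex f _⁻¹ _⁻¹ ⁻¹-involutive ⁻¹-involutive

  sum-⁻¹∙ : ∀ t (f : Fin n → ℤ) → sum (λ x → f ((x ⁻¹) ∙ t)) ≡ sum f
  sum-⁻¹∙ t f = sym (trans (sum-∙ʳ t f) (sum-⁻¹ (λ x → f (x ∙ t))))

module NaturalPowers where

  open import Data.Nat
  open import Data.Nat.Properties
  open import Data.Nat.Tactic.RingSolver using (solve-∀)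
  open import Relation.Binary.PropositionalEquality
  open import Relation.Nullary using (contradiction)

  ^-distribʳ-* : ∀ m n k → (m * n) ^ k ≡ m ^ k * n ^ k
  ^-distribʳ-* m n zero    = refl
  ^-distribʳ-* m n (suc k) = trans (cong (m * n *_) (^-distribʳ-* m n k)) (interchange m n (m ^ k) (n ^ k))
    where
    interchange : ∀ m n x y → m * n * (x * y) ≡ m * x * (n * y)
    interchange = solve-∀

  main-term-dominates : ∀ q m d .{{_ : NonZero q}} → q ^ (d + 2) < m ^ (2 * d + 2) →
    (q * q * m) * ((m * m * q) ^ d * (q * q * m)) < (q * (m * ((m * m) ^ d * m))) * (q * (m * ((m * m) ^ d * m)))
  main-term-dominates q zero d hyp = contradiction (subst (q ^ (d + 2) <_) 0^[2d+2]≡0 hyp) n≮0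
    where
    0^[2d+2]≡0 : 0 ^ (2 * d + 2) ≡ 0
    0^[2d+2]≡0 = cong (0 ^_) (+-comm (2 * d) 2)
  main-term-dominates q m@(suc _) d hyp =
    subst₂ _<_ (trans (lhs q m a b) (cong (λ t → q * q * m * (t * (q * q * m))) (sym mmqᵈ)))
               (trans (rhs q m a) (cong (λ t → q * (m * (t * m)) * (q * (m * (t * m)))) (sym mmᵈ)))
               (*-monoˡ-< (q * q * a * a * m * m) {{W≢0}} (subst₂ _<_ qᵈ⁺² m²ᵈ⁺² hyp))
    where
    a = m ^ d
    b = q ^ d
    mmᵈ : (m * m) ^ d ≡ a * a
    mmᵈ = ^-distribʳ-* m m d
    mmqᵈ : (m * m * q) ^ d ≡ a * a * b
    mmqᵈ = trans (^-distribʳ-* (m * m) q d) (cong (_* b) mmᵈ)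
    qᵈ⁺² : q ^ (d + 2) ≡ b * (q * (q * 1))
    qᵈ⁺² = ^-distribˡ-+-* q d 2
    m²ᵈ⁺² : m ^ (2 * d + 2) ≡ a * a * (m * (m * 1))
    m²ᵈ⁺² = trans (^-distribˡ-+-* m (2 * d) 2)
                  (cong (_* (m * (m * 1))) (trans (^-distribˡ-+-* m d (d + 0)) (cong (λ k → a * m ^ k) (+-identityʳ d))))
    W≢0 : NonZero (q * q * a * a * m * m)
    W≢0 = m*n≢0 _ m {{m*n≢0 _ m {{m*n≢0 _ a {{m*n≢0 _ a {{m*n≢0 q q}} {{m^n≢0 m d}}}} {{m^n≢0 m d}}}}}}
    lhs : ∀ q m a b → b * (q * (q * 1)) * (q * q * a * a * m * m) ≡ q * q * m * (a * a * b * (q * q * m))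
    lhs = solve-∀
    rhs : ∀ q m a → a * a * (m * (m * 1)) * (q * q * a * a * m * m) ≡ q * (m * (a * a * m)) * (q * (m * (a * a * m)))
    rhs = solve-∀

module QuasifieldSums {q} (Q : Quasifield q) where

  open import Data.Integer using (ℤ)
  open import Data.Product using (proj₁; proj₂)
  open import Function using (_∘_)
  open import Relation.Binary.PropositionalEquality

  open Quasifield Q renaming (_+_ to _⊕_; _·_ to _⊙_; -_ to ⊖_)
  open GroupSums +-isGroup public
  open Integers using (sum; sum-cong-≗; sum-reindex)
  open IsGroup +-isGroup using (identityˡ; inverseʳ)

  ⊙-zeroʳ : ∀ a → a ⊙ 0# ≡ 0#
  ⊙-zeroʳ a = begin
    a ⊙ 0#                          ≡⟨ //-rightDividesʳ (a ⊙ 0#) (a ⊙ 0#) ⟨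
    (a ⊙ 0# ⊕ a ⊙ 0#) ⊕ ⊖ (a ⊙ 0#)  ≡⟨ cong (_⊕ ⊖ (a ⊙ 0#)) (distribˡ a 0# 0#) ⟨
    a ⊙ (0# ⊕ 0#) ⊕ ⊖ (a ⊙ 0#)      ≡⟨ cong (λ t → a ⊙ t ⊕ ⊖ (a ⊙ 0#)) (identityˡ 0#) ⟩
    a ⊙ 0# ⊕ ⊖ (a ⊙ 0#)             ≡⟨ inverseʳ (a ⊙ 0#) ⟩
    0#                              ∎
    where open ≡-Reasoning

  ⊖‿distribʳ-⊙ : ∀ a x → ⊖ (a ⊙ x) ≡ a ⊙ ⊖ x
  ⊖‿distribʳ-⊙ a x = sym (inverseʳ-unique (a ⊙ x) (a ⊙ ⊖ x)
    (trans (sym (distribˡ a x (⊖ x))) (trans (cong (a ⊙_) (inverseʳ x)) (⊙-zeroʳ a))))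

  -- unique-sol says precisely that y ↦ − b′y + by is a bijection when b ≢ b′.
  module _ {b b′ : Fin q} (b≢b′ : b ≢ b′) where

    private
      difference : Fin q → Fin q
      difference y = ⊖ (b′ ⊙ y) ⊕ b ⊙ y

      solution : Fin q → Fin q
      solution t = proj₁ (unique-sol b b′ t b≢b′)

      difference-solution : ∀ t → difference (solution t) ≡ t
      difference-solution t = trans (cong (⊖ (b′ ⊙ x) ⊕_) (proj₁ (proj₂ (unique-sol b b′ t b≢b′))))
                                    (\\-leftDividesʳ (b′ ⊙ x) t)
        where x = solution t

      solution-difference : ∀ y → solution (difference y) ≡ y
      solution-difference y = sym (proj₂ (proj₂ (unique-sol b b′ (difference y) b≢b′)) y
                                     (sym (\\-leftDividesˡ (b′ ⊙ y) (b ⊙ y))))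

    sum-difference : ∀ (g : Fin q → ℤ) → sum (λ c → g (b′ ⊙ c ⊕ ⊖ (b ⊙ c))) ≡ sum g
    sum-difference g = sym (begin
      sum g                               ≡⟨ sum-reindex g difference solution difference-solution solution-difference ⟩
      sum (λ y → g (difference y))        ≡⟨ sum-⁻¹ (g ∘ difference) ⟩
      sum (λ c → g (difference (⊖ c)))    ≡⟨ sum-cong-≗ (λ c → cong g (difference-⊖ c)) ⟩
      sum (λ c → g (b′ ⊙ c ⊕ ⊖ (b ⊙ c)))  ∎)
      where
      open ≡-Reasoning
      difference-⊖ : ∀ c → difference (⊖ c) ≡ b′ ⊙ c ⊕ ⊖ (b ⊙ c)
      difference-⊖ c = cong₂ _⊕_ (trans (cong ⊖_ (sym (⊖‿distribʳ-⊙ b′ c))) (⁻¹-involutive (b′ ⊙ c)))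
                                 (sym (⊖‿distribʳ-⊙ b c))

module Convolution {q} (Q : Quasifield q) (A : Subset q) where

  open import Data.Nat as ℕ using (ℕ; zero; suc)
  open import Data.Integer using (ℤ; +_; 0ℤ; _+_; _*_; _^_; _≤_; nonNegative)
  import Data.Integer.Properties as ℤ
  open import Data.Integer.Tactic.RingSolver using (solve-∀)
  open import Function using (_∘_)
  open import Relation.Binary.PropositionalEquality

  open Quasifield Q renaming (_+_ to _⊕_; _·_ to _⊙_; -_ to ⊖_)
  open QuasifieldSums Q
  open Integers
  open IsGroup +-isGroup using (assoc)

  ι : Fin q → ℤ
  ι = indicator A

  M : ℤ
  M = + ∣ A ∣

  [M*M*q]^k≥0 : ∀ k → 0ℤ ≤ (M * M * + q) ^ k
  [M*M*q]^k≥0 k = ^-nonNeg k (*-nonNeg (*-nonNeg (pos-nonNeg ∣ A ∣) (pos-nonNeg ∣ A ∣)) (pos-nonNeg q))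

  P : (Fin q → ℤ) → Fin q → ℤ
  P h w = ∑[ b < q ] ∑[ c < q ] (ι b * (ι c * h (w ⊕ ⊖ (b ⊙ c))))

  -- Pᵏ k μ z sums μ x over the ways of writing z = ((x + b₁c₁) + ⋯) + b_k c_k with bᵢ, cᵢ ∈ A:
  -- applying P innermost gives exactly the bracketing of addProds.
  Pᵏ : ℕ → (Fin q → ℤ) → Fin q → ℤ
  Pᵏ zero    h = h
  Pᵏ (suc k) h = Pᵏ k (P h)

  P-cong : ∀ {g h} → (∀ x → g x ≡ h x) → ∀ w → P g w ≡ P h w
  P-cong g≗h w = sum-cong-≗ (λ b → sum-cong-≗ (λ c → cong (λ t → ι b * (ι c * t)) (g≗h _)))

  Pᵏ-cong : ∀ k {g h} → (∀ x → g x ≡ h x) → ∀ w → Pᵏ k g w ≡ Pᵏ k h w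
  Pᵏ-cong zero    g≗h = g≗h
  Pᵏ-cong (suc k) g≗h = Pᵏ-cong k (P-cong g≗h)

  ∑∑-distribˡ : ∀ i (f : Fin q → Fin q → ℤ) → i * ∑[ b < q ] ∑[ c < q ] f b c ≡ ∑[ b < q ] ∑[ c < q ] (i * f b c)
  ∑∑-distribˡ i f = trans (*-distribˡ-sum {q} i (λ b → sum (f b))) (sum-cong-≗ (λ b → *-distribˡ-sum i (f b)))

  P-linear : ∀ (c : Fin q → ℤ) (g : Fin q → Fin q → ℤ) w →
    P (λ x → ∑[ a < q ] (c a * g a x)) w ≡ ∑[ a < q ] (c a * P (g a) w)
  P-linear c g w = begin
    ∑[ b < q ] ∑[ b′ < q ] (ι b * (ι b′ * ∑[ a < q ] (c a * g a (w ⊕ ⊖ (b ⊙ b′)))))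
      ≡⟨ sum-cong-≗ (λ b → sum-cong-≗ (λ b′ → distribute b b′)) ⟩
    ∑[ b < q ] ∑[ b′ < q ] ∑[ a < q ] (c a * (ι b * (ι b′ * g a (w ⊕ ⊖ (b ⊙ b′)))))
      ≡⟨ ∑-comm₃ (λ a b b′ → c a * (ι b * (ι b′ * g a (w ⊕ ⊖ (b ⊙ b′))))) ⟨
    ∑[ a < q ] ∑[ b < q ] ∑[ b′ < q ] (c a * (ι b * (ι b′ * g a (w ⊕ ⊖ (b ⊙ b′)))))
      ≡⟨ sum-cong-≗ (λ a → ∑∑-distribˡ (c a) (λ b b′ → ι b * (ι b′ * g a (w ⊕ ⊖ (b ⊙ b′))))) ⟨
    ∑[ a < q ] (c a * P (g a) w) ∎
    where
    open ≡-Reasoning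
    regroup : ∀ i j k x → i * (j * (k * x)) ≡ k * (i * (j * x))
    regroup = solve-∀
    distribute : ∀ b b′ → ι b * (ι b′ * ∑[ a < q ] (c a * g a (w ⊕ ⊖ (b ⊙ b′))))
                          ≡ ∑[ a < q ] (c a * (ι b * (ι b′ * g a (w ⊕ ⊖ (b ⊙ b′)))))
    distribute b b′ = trans (cong (ι b *_) (*-distribˡ-sum {q} (ι b′) _))
      (trans (*-distribˡ-sum {q} (ι b) _) (sum-cong-≗ (λ a → regroup (ι b) (ι b′) (c a) (g a (w ⊕ ⊖ (b ⊙ b′))))))

  Pᵏ-linear : ∀ k (c : Fin q → ℤ) (g : Fin q → Fin q → ℤ) w →
    Pᵏ k (λ x → ∑[ a < q ] (c a * g a x)) w ≡ ∑[ a < q ] (c a * Pᵏ k (g a) w)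
  Pᵏ-linear zero    c g w = refl
  Pᵏ-linear (suc k) c g w = trans (Pᵏ-cong k (P-linear c g) w) (Pᵏ-linear k c (P ∘ g) w)

  ∑∑-+ : ∀ (f g : Fin q → Fin q → ℤ) →
    ∑[ b < q ] ∑[ c < q ] (f b c + g b c) ≡ ∑[ b < q ] ∑[ c < q ] f b c + ∑[ b < q ] ∑[ c < q ] g b c
  ∑∑-+ f g = trans (sum-cong-≗ (λ b → ∑-distrib-+ (f b) (g b))) (∑-distrib-+ (λ b → sum (f b)) (λ b → sum (g b)))

  P-const : ∀ e w → P (λ _ → e) w ≡ M * M * e
  P-const e w = begin
    ∑[ b < q ] ∑[ c < q ] (ι b * (ι c * e)) ≡⟨ sum-cong-≗ (λ b → *-distribˡ-sum {q} (ι b) (λ c → ι c * e)) ⟨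
    ∑[ b < q ] (ι b * ∑[ c < q ] (ι c * e)) ≡⟨ sum-cong-≗ (λ b → cong (ι b *_) (*-distribʳ-sum {q} e ι)) ⟨
    ∑[ b < q ] (ι b * (sum ι * e))          ≡⟨ *-distribʳ-sum {q} (sum ι * e) ι ⟨
    sum ι * (sum ι * e)                     ≡⟨ cong (λ s → s * (s * e)) (sum-indicator A) ⟩
    M * (M * e)                             ≡⟨ ℤ.*-assoc M M e ⟨
    M * M * e                               ∎
    where open ≡-Reasoning

  P-affine : ∀ c h e w → P (λ x → c * h x + e) w ≡ c * P h w + M * M * e
  P-affine c h e w = begin
    ∑[ b < q ] ∑[ b′ < q ] (ι b * (ι b′ * (c * h (w ⊕ ⊖ (b ⊙ b′)) + e)))
      ≡⟨ sum-cong-≗ (λ b → sum-cong-≗ (λ b′ → expand (ι b) (ι b′) c (h (w ⊕ ⊖ (b ⊙ b′))) e)) ⟩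
    ∑[ b < q ] ∑[ b′ < q ] (c * (ι b * (ι b′ * h (w ⊕ ⊖ (b ⊙ b′)))) + ι b * (ι b′ * e))
      ≡⟨ ∑∑-+ _ _ ⟩
    ∑[ b < q ] ∑[ b′ < q ] (c * (ι b * (ι b′ * h (w ⊕ ⊖ (b ⊙ b′))))) + P (λ _ → e) w
      ≡⟨ cong₂ _+_ (sym (∑∑-distribˡ c _)) (P-const e w) ⟩
    c * P h w + M * M * e
      ∎
    where
    open ≡-Reasoning
    expand : ∀ i j c x e → i * (j * (c * x + e)) ≡ c * (i * (j * x)) + i * (j * e)
    expand = solve-∀

  Pᵏ-affine : ∀ k c h e w → Pᵏ k (λ x → c * h x + e) w ≡ c * Pᵏ k h w + (M * M) ^ k * e
  Pᵏ-affine zero    c h e w = cong (λ t → c * h w + t) (sym (ℤ.*-identityˡ e))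
  Pᵏ-affine (suc k) c h e w = begin
    Pᵏ k (P (λ x → c * h x + e)) w      ≡⟨ Pᵏ-cong k (P-affine c h e) w ⟩
    Pᵏ k (λ x → c * P h x + M * M * e) w ≡⟨ Pᵏ-affine k c (P h) (M * M * e) w ⟩
    c * Pᵏ k (P h) w + (M * M) ^ k * (M * M * e)
                                        ≡⟨ cong (λ t → c * Pᵏ k (P h) w + t) (regroup (M * M) ((M * M) ^ k) e) ⟩
    c * Pᵏ k (P h) w + (M * M) ^ suc k * e ∎
    where
    open ≡-Reasoning
    regroup : ∀ x y e → y * (x * e) ≡ x * y * e
    regroup = solve-∀

  P-translate : ∀ u h w → P (λ x → h (u ⊕ x)) w ≡ P h (u ⊕ w)
  P-translate u h w = sum-cong-≗ (λ b → sum-cong-≗ (λ c → cong (λ t → ι b * (ι c * h t)) (sym (assoc u w _))))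

  Pᵏ-translate : ∀ k u h w → Pᵏ k (λ x → h (u ⊕ x)) w ≡ Pᵏ k h (u ⊕ w)
  Pᵏ-translate zero    u h w = refl
  Pᵏ-translate (suc k) u h w = trans (Pᵏ-cong k (P-translate u h) w) (Pᵏ-translate k u (P h) w)

  P-mean-zero : ∀ h → sum h ≡ 0ℤ → sum (P h) ≡ 0ℤ
  P-mean-zero h ∑h≡0 = begin
    ∑[ w < q ] ∑[ b < q ] ∑[ c < q ] (ι b * (ι c * h (w ⊕ ⊖ (b ⊙ c))))
      ≡⟨ ∑-comm₃ (λ w b c → ι b * (ι c * h (w ⊕ ⊖ (b ⊙ c)))) ⟩
    ∑[ b < q ] ∑[ c < q ] ∑[ w < q ] (ι b * (ι c * h (w ⊕ ⊖ (b ⊙ c))))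
      ≡⟨ sum-cong-≗ (λ b → sum-cong-≗ (λ c → vanishes b c)) ⟩
    ∑[ b < q ] ∑[ c < q ] 0ℤ
      ≡⟨ trans (sum-cong-≗ {q} (λ _ → sum-replicate-zero q)) (sum-replicate-zero q) ⟩
    0ℤ ∎
    where
    open ≡-Reasoning
    vanishes : ∀ b c → ∑[ w < q ] (ι b * (ι c * h (w ⊕ ⊖ (b ⊙ c)))) ≡ 0ℤ
    vanishes b c = begin
      ∑[ w < q ] (ι b * (ι c * h (w ⊕ ⊖ (b ⊙ c)))) ≡⟨ *-distribˡ-sum {q} (ι b) _ ⟨
      ι b * ∑[ w < q ] (ι c * h (w ⊕ ⊖ (b ⊙ c)))   ≡⟨ cong (ι b *_) (*-distribˡ-sum {q} (ι c) _) ⟨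
      ι b * (ι c * ∑[ w < q ] h (w ⊕ ⊖ (b ⊙ c)))   ≡⟨ cong (λ s → ι b * (ι c * s)) (trans (sym (sum-∙ʳ _ h)) ∑h≡0) ⟩
      ι b * (ι c * 0ℤ)                             ≡⟨ trans (cong (ι b *_) (ℤ.*-zeroʳ (ι c))) (ℤ.*-zeroʳ (ι b)) ⟩
      0ℤ                                           ∎

  Pᵏ-mean-zero : ∀ k h → sum h ≡ 0ℤ → sum (Pᵏ k h) ≡ 0ℤ
  Pᵏ-mean-zero zero    h ∑h≡0 = ∑h≡0
  Pᵏ-mean-zero (suc k) h ∑h≡0 = Pᵏ-mean-zero k (P h) (P-mean-zero h ∑h≡0)

  slice : (Fin q → ℤ) → Fin q → Fin q → ℤ
  slice h c w = ∑[ b < q ] (ι b * h (w ⊕ ⊖ (b ⊙ c)))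

  P-slices : ∀ h w → P h w ≡ ∑[ c < q ] (ι c * slice h c w)
  P-slices h w = trans (∑-comm (λ b c → ι b * (ι c * h (w ⊕ ⊖ (b ⊙ c)))))
    (sum-cong-≗ (λ c → trans (sum-cong-≗ (λ b → swap (ι b) (ι c) _)) (sym (*-distribˡ-sum {q} (ι c) _))))
    where
    swap : ∀ i j x → i * (j * x) ≡ j * (i * x)
    swap = solve-∀

  P²≤slices : ∀ h w → P h w * P h w ≤ M * ‖ (λ c → slice h c w) ‖²
  P²≤slices h w = subst (λ s → s * s ≤ M * ‖ (λ c → slice h c w) ‖²) (sym (P-slices h w))
    (subst (λ m → S * S ≤ m * ‖ (λ c → slice h c w) ‖²) (‖indicator‖² A) (cauchy-schwarz ι (λ c → slice h c w)))
    where S = ∑[ c < q ] (ι c * slice h c w)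

  correlation : (Fin q → ℤ) → Fin q → Fin q → ℤ
  correlation h b b′ = ∑[ c < q ] ∑[ w < q ] (h (w ⊕ ⊖ (b ⊙ c)) * h (w ⊕ ⊖ (b′ ⊙ c)))

  correlation-≢ : ∀ h → sum h ≡ 0ℤ → ∀ {b b′} → b ≢ b′ → correlation h b b′ ≡ 0ℤ
  correlation-≢ h ∑h≡0 {b} {b′} b≢b′ = begin
    ∑[ c < q ] ∑[ w < q ] (h (w ⊕ ⊖ (b ⊙ c)) * h (w ⊕ ⊖ (b′ ⊙ c)))
      ≡⟨ sum-cong-≗ (λ c → trans (sum-∙ʳ (b′ ⊙ c) _) (sum-cong-≗ (λ v → shift c v))) ⟩
    ∑[ c < q ] ∑[ v < q ] (h (v ⊕ (b′ ⊙ c ⊕ ⊖ (b ⊙ c))) * h v)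
      ≡⟨ ∑-comm (λ c v → h (v ⊕ (b′ ⊙ c ⊕ ⊖ (b ⊙ c))) * h v) ⟩
    ∑[ v < q ] ∑[ c < q ] (h (v ⊕ (b′ ⊙ c ⊕ ⊖ (b ⊙ c))) * h v)
      ≡⟨ sum-cong-≗ (λ v → *-distribʳ-sum {q} (h v) _) ⟨
    ∑[ v < q ] (∑[ c < q ] h (v ⊕ (b′ ⊙ c ⊕ ⊖ (b ⊙ c))) * h v)
      ≡⟨ sum-cong-≗ (λ v → cong (_* h v) (translates-vanish v)) ⟩
    ∑[ v < q ] (0ℤ * h v)
      ≡⟨ sum-replicate-zero q ⟩
    0ℤ ∎
    where
    open ≡-Reasoning
    shift : ∀ c v → h ((v ⊕ b′ ⊙ c) ⊕ ⊖ (b ⊙ c)) * h ((v ⊕ b′ ⊙ c) ⊕ ⊖ (b′ ⊙ c))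
                  ≡ h (v ⊕ (b′ ⊙ c ⊕ ⊖ (b ⊙ c))) * h v
    shift c v = cong₂ _*_ (cong h (assoc v _ _)) (cong h (//-rightDividesʳ (b′ ⊙ c) v))
    translates-vanish : ∀ v → ∑[ c < q ] h (v ⊕ (b′ ⊙ c ⊕ ⊖ (b ⊙ c))) ≡ 0ℤ
    translates-vanish v = trans (sum-difference b≢b′ (λ t → h (v ⊕ t))) (trans (sym (sum-∙ˡ v h)) ∑h≡0)

  correlation-≡ : ∀ h b → correlation h b b ≡ + q * ‖ h ‖²
  correlation-≡ h b = trans (sum-cong-≗ (λ c → sym (sum-∙ʳ (⊖ (b ⊙ c)) (λ w → h w * h w)))) (sum-const q ‖ h ‖²)

  slices-energy : ∀ h → sum h ≡ 0ℤ → ∑[ c < q ] ‖ slice h c ‖² ≡ M * (+ q * ‖ h ‖²)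
  slices-energy h ∑h≡0 = begin
    ∑[ c < q ] ∑[ w < q ] (slice h c w * slice h c w)
      ≡⟨ sum-cong-≗ (λ c → sum-cong-≗ (λ w → square-sum (λ b → ι b * h (w ⊕ ⊖ (b ⊙ c))))) ⟩
    ∑[ c < q ] ∑[ w < q ] ∑[ b < q ] ∑[ b′ < q ] X c w b b′
      ≡⟨ sum-cong-≗ (λ c → ∑-comm₃ (X c)) ⟩
    ∑[ c < q ] ∑[ b < q ] ∑[ b′ < q ] ∑[ w < q ] X c w b b′
      ≡⟨ ∑-comm₃ (λ c b b′ → ∑[ w < q ] X c w b b′) ⟩
    ∑[ b < q ] ∑[ b′ < q ] ∑[ c < q ] ∑[ w < q ] X c w b b′
      ≡⟨ sum-cong-≗ (λ b → sum-cong-≗ (λ b′ → factor b b′)) ⟩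
    ∑[ b < q ] ∑[ b′ < q ] (ι b * ι b′ * correlation h b b′)
      ≡⟨ sum-cong-≗ (λ b → sum-single-support _ b (λ b′ b′≢b → off-diagonal b b′ b′≢b)) ⟩
    ∑[ b < q ] (ι b * ι b * correlation h b b)
      ≡⟨ sum-cong-≗ (λ b → cong₂ _*_ (indicator-idem A b) (correlation-≡ h b)) ⟩
    ∑[ b < q ] (ι b * (+ q * ‖ h ‖²))
      ≡⟨ *-distribʳ-sum {q} (+ q * ‖ h ‖²) ι ⟨
    sum ι * (+ q * ‖ h ‖²)
      ≡⟨ cong (_* (+ q * ‖ h ‖²)) (sum-indicator A) ⟩
    M * (+ q * ‖ h ‖²) ∎
    where
    open ≡-Reasoning
    X : Fin q → Fin q → Fin q → Fin q → ℤ
    X c w b b′ = ι b * h (w ⊕ ⊖ (b ⊙ c)) * (ι b′ * h (w ⊕ ⊖ (b′ ⊙ c)))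
    regroup : ∀ i j x y → i * x * (j * y) ≡ i * j * (x * y)
    regroup = solve-∀
    factor : ∀ b b′ → ∑[ c < q ] ∑[ w < q ] X c w b b′ ≡ ι b * ι b′ * correlation h b b′
    factor b b′ = trans (sum-cong-≗ {q} (λ c → sum-cong-≗ {q} (λ w → regroup (ι b) (ι b′) _ _)))
                        (sym (∑∑-distribˡ (ι b * ι b′) (λ c w → h (w ⊕ ⊖ (b ⊙ c)) * h (w ⊕ ⊖ (b′ ⊙ c)))))
    off-diagonal : ∀ b b′ → b′ ≢ b → ι b * ι b′ * correlation h b b′ ≡ 0ℤ
    off-diagonal b b′ b′≢b =
      trans (cong (ι b * ι b′ *_) (correlation-≢ h ∑h≡0 (b′≢b ∘ sym))) (ℤ.*-zeroʳ (ι b * ι b′))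

  P-norm : ∀ h → sum h ≡ 0ℤ → ‖ P h ‖² ≤ M * M * + q * ‖ h ‖²
  P-norm h ∑h≡0 = begin
    ‖ P h ‖²                                 ≤⟨ sum-mono-≤ (P²≤slices h) ⟩
    ∑[ w < q ] (M * ‖ (λ c → slice h c w) ‖²) ≡⟨ *-distribˡ-sum {q} M _ ⟨
    M * ∑[ w < q ] ‖ (λ c → slice h c w) ‖²  ≡⟨ cong (M *_) (∑-comm (λ w c → slice h c w * slice h c w)) ⟩
    M * ∑[ c < q ] ‖ slice h c ‖²            ≡⟨ cong (M *_) (slices-energy h ∑h≡0) ⟩
    M * (M * (+ q * ‖ h ‖²))                 ≡⟨ regroup M (+ q) ‖ h ‖² ⟩
    M * M * + q * ‖ h ‖²                     ∎
    where
    open ℤ.≤-Reasoning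
    regroup : ∀ m q n → m * (m * (q * n)) ≡ m * m * q * n
    regroup = solve-∀

  Pᵏ-norm : ∀ k h → sum h ≡ 0ℤ → ‖ Pᵏ k h ‖² ≤ (M * M * + q) ^ k * ‖ h ‖²
  Pᵏ-norm zero    h _    = ℤ.≤-reflexive (sym (ℤ.*-identityˡ ‖ h ‖²))
  Pᵏ-norm (suc k) h ∑h≡0 = begin
    ‖ Pᵏ k (P h) ‖²      ≤⟨ Pᵏ-norm k (P h) (P-mean-zero h ∑h≡0) ⟩
    C ^ k * ‖ P h ‖²     ≤⟨ ℤ.*-monoˡ-≤-nonNeg (C ^ k) {{nonNegative ([M*M*q]^k≥0 k)}} (P-norm h ∑h≡0) ⟩
    C ^ k * (C * ‖ h ‖²) ≡⟨ regroup C (C ^ k) ‖ h ‖² ⟩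
    C ^ suc k * ‖ h ‖²   ∎
    where
    open ℤ.≤-Reasoning
    C = M * M * + q
    regroup : ∀ c x n → x * (c * n) ≡ c * x * n
    regroup = solve-∀

module Representations {q} (Q : Quasifield q) (A : Subset q) where

  open import Data.Nat as ℕ using (ℕ; zero; suc)
  import Data.Nat.Properties as ℕ using (<⇒≱)
  open import Data.Integer using (ℤ; +_; 0ℤ; _+_; _*_; -_; _-_; _^_; _≤_; nonNegative)
  import Data.Integer.Properties as ℤ
  open import Data.Integer.Tactic.RingSolver using (solve-∀)
  open import Data.Vec.Functional using (_∷_)
  open import Relation.Binary.PropositionalEquality
  open NaturalPowers using (main-term-dominates)

  open Quasifield Q renaming (_+_ to _⊕_; _·_ to _⊙_; -_ to ⊖_)
  open QuasifieldSums Q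
  open Integers
  open Convolution Q A

  ProductSum : (k : ℕ) → Fin q → Fin q → Set
  ProductSum k y z = Σ (Fin k → Fin q) λ b → Σ (Fin k → Fin q) λ c →
    (∀ i → b i ∈ A) × (∀ i → c i ∈ A) × z ≡ addProds Q y k b c

  P≢0⇒∃product : ∀ μ y → P μ y ≢ 0ℤ →
    Σ (Fin q) λ b → Σ (Fin q) λ c → b ∈ A × c ∈ A × μ (y ⊕ ⊖ (b ⊙ c)) ≢ 0ℤ
  P≢0⇒∃product μ y Pμy≢0 with sum≢0⇒∃≢0 _ Pμy≢0
  ... | b , ≢0 with sum≢0⇒∃≢0 _ ≢0
  ...   | c , ιb*[ιc*μ]≢0 =
    b , c , indicator≢0⇒∈ A b (i*j≢0⇒i≢0 (ι b) (ι c * μx) ιb*[ιc*μ]≢0) ,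
    indicator≢0⇒∈ A c (i*j≢0⇒i≢0 (ι c) μx ιc*μ≢0) , i*j≢0⇒j≢0 (ι c) μx ιc*μ≢0
    where
    μx = μ (y ⊕ ⊖ (b ⊙ c))
    ιc*μ≢0 = i*j≢0⇒j≢0 (ι b) (ι c * μx) ιb*[ιc*μ]≢0

  Pᵏ≢0⇒product-sum : ∀ k μ z → Pᵏ k μ z ≢ 0ℤ → Σ (Fin q) λ y → μ y ≢ 0ℤ × ProductSum k y z
  Pᵏ≢0⇒product-sum zero    μ z μz≢0 = z , μz≢0 , (λ ()) , (λ ()) , (λ ()) , (λ ()) , refl
  Pᵏ≢0⇒product-sum (suc k) μ z ≢0 with Pᵏ≢0⇒product-sum k (P μ) z ≢0
  ... | y , Pμy≢0 , b , c , b∈A , c∈A , z≡ with P≢0⇒∃product μ y Pμy≢0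
  ...   | b₀ , c₀ , b₀∈A , c₀∈A , μ≢0 =
    y ⊕ ⊖ (b₀ ⊙ c₀) , μ≢0 , b₀ ∷ b , c₀ ∷ c ,
    (λ { Fin.zero → b₀∈A ; (Fin.suc i) → b∈A i }) , (λ { Fin.zero → c₀∈A ; (Fin.suc i) → c∈A i }) ,
    trans z≡ (cong (λ t → addProds Q t k b c) (sym (//-rightDividesˡ (b₀ ⊙ c₀) y)))

  count-A+A : Fin q → ℤ
  count-A+A x = ∑[ a < q ] (ι a * ι (⊖ a ⊕ x))

  count-A+A≢0⇒∈A+A : ∀ y → count-A+A y ≢ 0ℤ →
    Σ (Fin q) λ a → Σ (Fin q) λ a′ → a ∈ A × a′ ∈ A × a ⊕ a′ ≡ y
  count-A+A≢0⇒∈A+A y ≢0 with sum≢0⇒∃≢0 _ ≢0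
  ... | a , ιa*ιa′≢0 =
    a , ⊖ a ⊕ y , indicator≢0⇒∈ A a (i*j≢0⇒i≢0 (ι a) (ι (⊖ a ⊕ y)) ιa*ιa′≢0) ,
    indicator≢0⇒∈ A (⊖ a ⊕ y) (i*j≢0⇒j≢0 (ι a) (ι (⊖ a ⊕ y)) ιa*ιa′≢0) , \\-leftDividesˡ a y

  ∈A+A+A·A : ∀ d z → Pᵏ d count-A+A z ≢ 0ℤ →
    Σ (Fin q) λ a → Σ (Fin q) λ a′ → Σ (Fin d → Fin q) λ b → Σ (Fin d → Fin q) λ c →
      a ∈ A × a′ ∈ A × (∀ i → b i ∈ A) × (∀ i → c i ∈ A) × z ≡ addProds Q (a ⊕ a′) d b c
  ∈A+A+A·A d z ≢0 with Pᵏ≢0⇒product-sum d count-A+A z ≢0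
  ... | y , y∈supp , b , c , b∈A , c∈A , z≡ with count-A+A≢0⇒∈A+A y y∈supp
  ...   | a , a′ , a∈A , a′∈A , refl = a , a′ , b , c , a∈A , a′∈A , b∈A , c∈A , z≡

  α : Fin q → ℤ
  α x = + q * ι x - M

  sum-qι : ∑[ x < q ] (+ q * ι x) ≡ + q * M
  sum-qι = trans (sym (*-distribˡ-sum {q} (+ q) ι)) (cong (+ q *_) (sum-indicator A))

  sum-α : sum α ≡ 0ℤ
  sum-α = begin
    ∑[ x < q ] (+ q * ι x + - M)         ≡⟨ ∑-distrib-+ (λ x → + q * ι x) (λ _ → - M) ⟩
    ∑[ x < q ] (+ q * ι x) + ∑[ _ < q ] (- M) ≡⟨ cong₂ _+_ sum-qι (sum-const q (- M)) ⟩
    + q * M + + q * - M                  ≡⟨ cancel (+ q) M ⟩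
    0ℤ                                   ∎
    where
    open ≡-Reasoning
    cancel : ∀ a b → a * b + a * - b ≡ 0ℤ
    cancel = solve-∀

  ‖α‖²≤ : ‖ α ‖² ≤ + q * + q * M
  ‖α‖²≤ = begin
    ∑[ x < q ] ((+ q * ι x + - M) * (+ q * ι x + - M))
      ≡⟨ sum-shifted-product (λ x → + q * ι x) (λ x → + q * ι x) (- M) (- M) ⟩
    ∑[ x < q ] (+ q * ι x * (+ q * ι x)) + (- M * S + (- M * S + + q * (- M * - M)))
      ≡⟨ cong (_+ (- M * S + (- M * S + + q * (- M * - M)))) diagonal ⟩
    + q * + q * M + (- M * S + (- M * S + + q * (- M * - M)))
      ≡⟨ cong (λ s → + q * + q * M + (- M * s + (- M * s + + q * (- M * - M)))) sum-qι ⟩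
    + q * + q * M + (- M * (+ q * M) + (- M * (+ q * M) + + q * (- M * - M)))
      ≡⟨ simplify (+ q) M ⟩
    + q * + q * M - + q * (M * M)
      ≤⟨ ℤ.i-j≤i _ _ {{nonNegative (*-nonNeg (pos-nonNeg q) (*-nonNeg (pos-nonNeg ∣ A ∣) (pos-nonNeg ∣ A ∣)))}} ⟩
    + q * + q * M ∎
    where
    open ℤ.≤-Reasoning
    S = ∑[ x < q ] (+ q * ι x)
    regroup : ∀ a i → a * i * (a * i) ≡ a * a * (i * i)
    regroup = solve-∀
    simplify : ∀ a m → a * a * m + (- m * (a * m) + (- m * (a * m) + a * (- m * - m))) ≡ a * a * m - a * (m * m)
    simplify = solve-∀
    diagonal : ∑[ x < q ] (+ q * ι x * (+ q * ι x)) ≡ + q * + q * M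
    diagonal = trans (sum-cong-≗ (λ x → regroup (+ q) (ι x)))
                 (trans (sym (*-distribˡ-sum {q} (+ q * + q) _)) (cong (+ q * + q *_) (‖indicator‖² A)))

  module _ (d : ℕ) (z : Fin q) where

    β : Fin q → ℤ
    β = Pᵏ d α

    K : ℤ
    K = (M * M) ^ d * M

    error : ℤ
    error = ∑[ a < q ] (α a * β (⊖ a ⊕ z))

    Pᵏ-count-A+A : Pᵏ d count-A+A z ≡ ∑[ a < q ] (ι a * Pᵏ d ι (⊖ a ⊕ z))
    Pᵏ-count-A+A = trans (Pᵏ-linear d ι (λ a x → ι (⊖ a ⊕ x)) z)
                         (sum-cong-≗ (λ a → cong (ι a *_) (Pᵏ-translate d (⊖ a) ι z)))

    q*Pᵏι : ∀ y → + q * Pᵏ d ι y ≡ β y + K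
    q*Pᵏι y = begin
      + q * Pᵏ d ι y                                      ≡⟨ shift (+ q * Pᵏ d ι y) ((M * M) ^ d) M ⟩
      (+ q * Pᵏ d ι y + (M * M) ^ d * - M) + (M * M) ^ d * M ≡⟨ cong (_+ K) (Pᵏ-affine d (+ q) ι (- M) y) ⟨
      β y + K                                             ∎
      where
      open ≡-Reasoning
      shift : ∀ p x m → p ≡ (p + x * - m) + x * m
      shift = solve-∀

    count-expansion : + q * (+ q * Pᵏ d count-A+A z) ≡ error + + q * (M * K)
    count-expansion = begin
      + q * (+ q * Pᵏ d count-A+A z)
        ≡⟨ cong (λ s → + q * (+ q * s)) Pᵏ-count-A+A ⟩
      + q * (+ q * ∑[ a < q ] (ι a * Pᵏ d ι (⊖ a ⊕ z)))
        ≡⟨ trans (cong (+ q *_) (*-distribˡ-sum {q} (+ q) _)) (*-distribˡ-sum {q} (+ q) _) ⟩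
      ∑[ a < q ] (+ q * (+ q * (ι a * Pᵏ d ι (⊖ a ⊕ z))))
        ≡⟨ sum-cong-≗ (λ a → trans (regroup (+ q) (ι a) _) (cong₂ _*_ (split-ι a) (q*Pᵏι (⊖ a ⊕ z)))) ⟩
      ∑[ a < q ] ((α a + M) * (β (⊖ a ⊕ z) + K))
        ≡⟨ sum-shifted-product α (λ a → β (⊖ a ⊕ z)) M K ⟩
      error + (K * sum α + (M * ∑[ a < q ] β (⊖ a ⊕ z) + + q * (M * K)))
        ≡⟨ cong₂ (λ s t → error + (K * s + (M * t + + q * (M * K)))) sum-α
                 (trans (sum-⁻¹∙ z β) (Pᵏ-mean-zero d α sum-α)) ⟩
      error + (K * 0ℤ + (M * 0ℤ + + q * (M * K)))
        ≡⟨ cong (λ t → error + t) (vanish K M (+ q * (M * K))) ⟩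
      error + + q * (M * K) ∎
      where
      open ≡-Reasoning
      regroup : ∀ n i p → n * (n * (i * p)) ≡ n * i * (n * p)
      regroup = solve-∀
      split-ι : ∀ a → + q * ι a ≡ α a + M
      split-ι a = shift (+ q * ι a) M
        where
        shift : ∀ x m → x ≡ x + - m + m
        shift = solve-∀
      vanish : ∀ k m x → k * 0ℤ + (m * 0ℤ + x) ≡ x
      vanish = solve-∀

    error-bound : error * error ≤ (+ q * + q * M) * ((M * M * + q) ^ d * (+ q * + q * M))
    error-bound = begin
      error * error
        ≤⟨ cauchy-schwarz α (λ a → β (⊖ a ⊕ z)) ⟩
      ‖ α ‖² * ‖ (λ a → β (⊖ a ⊕ z)) ‖²
        ≡⟨ cong (‖ α ‖² *_) (sum-⁻¹∙ z (λ y → β y * β y)) ⟩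
      ‖ α ‖² * ‖ β ‖²
        ≤⟨ ℤ.*-monoˡ-≤-nonNeg ‖ α ‖² {{nonNegative (‖‖²-nonNeg α)}} (Pᵏ-norm d α sum-α) ⟩
      ‖ α ‖² * (C ^ d * ‖ α ‖²)
        ≤⟨ *-mono-≤-nonNeg (‖‖²-nonNeg α) (*-nonNeg ([M*M*q]^k≥0 d) Y≥0) ‖α‖²≤
             (ℤ.*-monoˡ-≤-nonNeg (C ^ d) {{nonNegative ([M*M*q]^k≥0 d)}} ‖α‖²≤) ⟩
      Y * (C ^ d * Y) ∎
      where
      open ℤ.≤-Reasoning
      C = M * M * + q
      Y = + q * + q * M
      Y≥0 : 0ℤ ≤ Y
      Y≥0 = *-nonNeg (*-nonNeg (pos-nonNeg q) (pos-nonNeg q)) (pos-nonNeg ∣ A ∣)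

    error-without-representation : Pᵏ d count-A+A z ≡ 0ℤ → error ≡ - (+ q * (M * K))
    error-without-representation count≡0 = begin
      error                                  ≡⟨ shift error X ⟩
      (error + X) + - X                      ≡⟨ cong (_+ - X) count-expansion ⟨
      + q * (+ q * Pᵏ d count-A+A z) + - X   ≡⟨ cong (λ t → + q * (+ q * t) + - X) count≡0 ⟩
      + q * (+ q * 0ℤ) + - X                 ≡⟨ vanish (+ q) X ⟩
      - X                                    ∎
      where
      open ≡-Reasoning
      X = + q * (M * K)
      shift : ∀ e x → e ≡ (e + x) + - x
      shift = solve-∀
      vanish : ∀ n x → n * (n * 0ℤ) + - x ≡ - x
      vanish = solve-∀

    private
      m = ∣ A ∣

    main-term-cast : + q * (M * K) ≡ + (q ℕ.* (m ℕ.* ((m ℕ.* m) ℕ.^ d ℕ.* m)))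
    main-term-cast = begin
      + q * (M * ((M * M) ^ d * M))           ≡⟨ cong (λ t → + q * (M * (t ^ d * M))) (ℤ.pos-* m m) ⟨
      + q * (M * ((+ (m ℕ.* m)) ^ d * M))     ≡⟨ cong (λ t → + q * (M * (t * M))) (pos-^ (m ℕ.* m) d) ⟨
      + q * (M * (+ ((m ℕ.* m) ℕ.^ d) * M))   ≡⟨ cong (λ t → + q * (M * t)) (ℤ.pos-* ((m ℕ.* m) ℕ.^ d) m) ⟨
      + q * (M * + ((m ℕ.* m) ℕ.^ d ℕ.* m))   ≡⟨ cong (+ q *_) (ℤ.pos-* m _) ⟨
      + q * + (m ℕ.* ((m ℕ.* m) ℕ.^ d ℕ.* m)) ≡⟨ ℤ.pos-* q _ ⟨
      + (q ℕ.* (m ℕ.* ((m ℕ.* m) ℕ.^ d ℕ.* m))) ∎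
      where open ≡-Reasoning

    error-bound-cast : (+ q * + q * M) * ((M * M * + q) ^ d * (+ q * + q * M))
                       ≡ + ((q ℕ.* q ℕ.* m) ℕ.* ((m ℕ.* m ℕ.* q) ℕ.^ d ℕ.* (q ℕ.* q ℕ.* m)))
    error-bound-cast = trans (cong₂ (λ s t → s * (t * s)) Y≡ Cᵈ≡)
                             (trans (cong (+ y *_) (sym (ℤ.pos-* c y))) (sym (ℤ.pos-* y (c ℕ.* y))))
      where
      y = q ℕ.* q ℕ.* m
      c = (m ℕ.* m ℕ.* q) ℕ.^ d
      Y≡ : + q * + q * M ≡ + y
      Y≡ = trans (cong (_* M) (sym (ℤ.pos-* q q))) (sym (ℤ.pos-* (q ℕ.* q) m))
      Cᵈ≡ : (M * M * + q) ^ d ≡ + c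
      Cᵈ≡ = trans (cong (λ t → (t * + q) ^ d) (sym (ℤ.pos-* m m)))
                  (trans (cong (_^ d) (sym (ℤ.pos-* (m ℕ.* m) q))) (sym (pos-^ (m ℕ.* m ℕ.* q) d)))

    count≢0 : .{{_ : ℕ.NonZero q}} → q ℕ.^ (d ℕ.+ 2) ℕ.< m ℕ.^ (2 ℕ.* d ℕ.+ 2) → Pᵏ d count-A+A z ≢ 0ℤ
    count≢0 hyp count≡0 =
      ℕ.<⇒≱ (main-term-dominates q m d hyp) (ℤ.drop‿+≤+ (subst₂ _≤_ main-term² error-bound-cast bound))
      where
      X = + q * (M * K)
      x = q ℕ.* (m ℕ.* ((m ℕ.* m) ℕ.^ d ℕ.* m))
      bound : - X * - X ≤ (+ q * + q * M) * ((M * M * + q) ^ d * (+ q * + q * M))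
      bound = subst (λ e → e * e ≤ _) (error-without-representation count≡0) error-bound
      neg² : ∀ i → - i * - i ≡ i * i
      neg² = solve-∀
      main-term² : - X * - X ≡ + (x ℕ.* x)
      main-term² = trans (neg² X) (trans (cong₂ _*_ main-term-cast main-term-cast) (sym (ℤ.pos-* x x)))

open import Data.Nat using (ℕ; zero; suc; _≤_; _<_; _^_; _*_; _+_)

theorem1p11 : (d : ℕ) → 1 ≤ d → (q : ℕ) → (Q : Quasifield q) → (A : Subset q)
    → q ^ (d + 2) < ∣ A ∣ ^ (2 * d + 2)
    → (z : Fin q) → Σ (Fin q) λ a → Σ (Fin q) λ a′ → Σ (Fin d → Fin q) λ b → Σ (Fin d → Fin q) λ c
    → a ∈ A × a′ ∈ A × (∀ i → b i ∈ A) × (∀ i → c i ∈ A)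
    × z ≡ addProds Q (Quasifield._+_ Q a a′) d b c
theorem1p11 d _ zero    Q A hyp ()
theorem1p11 d _ (suc _) Q A hyp z = ∈A+A+A·A d z (count≢0 d z hyp)
  where open Representations Q A
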